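{- In the $(q,n)$-lattice game, the minimum number of stages (i.e., of points in the constructed sequence) that builder needs in order to guarantee a point in the sequence with some coordinate at least $n$ is $(n-1)^q+1$.
   Context: The $(q,n)$-lattice game is played by builder and coordinator, who build a sequence $p_1,p_2,\dots$ of (not necessarily distinct) points of $\mathbb{Z}_{>0}^q$. In stage 1, coordinator chooses $p_1$. In stage $i+1$, a number of steps take place: in each step builder selects a point $p_j$ with $j\le i$ and coordinator responds with a coordinate $k\in[q]$, imposing the constraint that the $k$th coordinate of $p_{i+1}$ is strictly larger than the $k$th coordinate of $p_j$. Builder decides when to end the stage; then coordinator chooses $p_{i+1}\in\mathbb{Z}^q_{>0}$ satisfying all constraints of the stage. Here $n,q$ are positive integers. -}

module Defs where

open import Data.Nat using (ℕ; zero; suc; _≤_; _<_)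
open import Data.Fin using (Fin)
open import Data.List using (List; []; _∷_; length; lookup; _∷ʳ_)
open import Data.List.Relation.Unary.Any using (Any)
open import Data.List.Relation.Unary.All using (All)
open import Data.Product using (_×_; Σ; proj₁; proj₂; ∃)

-- A point of ℤ_{>0}^q, represented as a function Fin q → ℕ
-- together with the positivity requirement `Positive`.
Point : ℕ → Set
Point q = Fin q → ℕ

Positive : {q : ℕ} → Point q → Set
Positive p = ∀ k → 0 < p k

-- The sequence built so far: h = [p_1, ..., p_i].
-- A constraint of the current stage: (j , k) means
-- "the k-th coordinate of the new point must exceed the k-th coordinate of p_j".
Constraint : {q : ℕ} → List (Point q) → Set
Constraint {q} h = Fin (length h) × Fin q

Satisfies : {q : ℕ} (h : List (Point q)) → Constraint h → Point q → Set
Satisfies h c p = lookup h (proj₁ c) (proj₂ c) < p (proj₂ c)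

Reached : {q : ℕ} → ℕ → List (Point q) → Set
Reached {q} n h = Any (λ p → ∃ λ (k : Fin q) → n ≤ p k) h

-- Builder has a strategy guaranteeing that, within r further stages
-- (starting from the sequence h), some point has a coordinate ≥ n.
mutual
  data Win {q : ℕ} (n : ℕ) (h : List (Point q)) : ℕ → Set where
    done  : ∀ {r} → Reached n h → Win n h r
    stage : ∀ {r} → StageWin n h r [] → Win n h (suc r)

  -- Builder, in the middle of a stage with constraints cs collected so far,
  -- can force a win with r further stages remaining after this one.
  data StageWin {q : ℕ} (n : ℕ) (h : List (Point q)) (r : ℕ)
       : List (Constraint h) → Set where
    -- builder ends the stage; coordinator picks any admissible point
    end  : ∀ {cs} →
           (∀ (p : Point q) → Positive p → All (λ c → Satisfies h c p) cs →
              Win n (h ∷ʳ p) r) →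
           StageWin n h r cs
    -- builder selects p_j; coordinator answers with any coordinate k
    step : ∀ {cs} (j : Fin (length h)) →
           (∀ (k : Fin q) → StageWin n h r ((j Data.Product., k) ∷ cs)) →
           StageWin n h r cs

BuilderWinsIn : (q n N : ℕ) → Set
BuilderWinsIn q n N = Win {q} n [] N

module Submission where

-- Both bounds revolve around escaping sequences: lists of points in which
-- every point exceeds each earlier point in at least one coordinate.
--
-- Builder: in every stage builder selects every earlier point once.  Whatever
-- coordinator answers, the new point exceeds each earlier one somewhere, so
-- the sequence stays escaping.  Hence if every escaping sequence of more than
-- M positive points reaches n, builder wins within M + 1 stages.
--
-- Coordinator: given a sequence e₀, e₁, … of positive points with all
-- coordinates below n whose first M terms are escaping, coordinator plays eᵢ
-- as the (i+1)-st point and answers the selection of eⱼ (j < i) with a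
-- coordinate where eⱼ < eᵢ.  Builder then needs more than M stages.
--
-- For n = B + 1 with B ≥ 1 both hypotheses are supplied by base-B digits:
-- the digit vectors of 0, 1, …, B^q − 1 (shifted to [1,B]) form an escaping
-- sequence filling the box [1,B]^q, so by pigeonhole no escaping sequence in
-- the box is longer than B^q.  For n = 1 builder wins in one stage, and no
-- builder wins without playing a stage.

open import Defs
open import Data.Nat using (ℕ; zero; suc; pred; _≤_; _<_; _+_; _∸_; _^_; _*_;
  z≤n; s≤s; z<s; s<s; NonZero; >-nonZero; _≤?_; _<?_)
open import Data.Nat.Properties
open import Data.Nat.DivMod
open import Data.Fin as Fin using (Fin; toℕ; fromℕ<)
import Data.Fin.Properties as Finₚ
open import Data.List using (List; []; _∷_; length; lookup; _∷ʳ_; allFin)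
open import Data.List.Properties using (length-++; tabulate-lookup)
open import Data.List.Membership.Propositional.Properties using (∈-lookup; ∈-allFin)
open import Data.List.Relation.Unary.Any as Any using (Any; here)
open import Data.List.Relation.Unary.All as All using (All; []; _∷_)
open import Data.List.Relation.Unary.All.Properties using (∷ʳ⁺; tabulate⁺; ¬Any⇒All¬; All¬⇒¬Any)
open import Data.List.Relation.Unary.AllPairs using (AllPairs; []; _∷_)
import Data.List.Relation.Unary.AllPairs.Properties as AllPairsₚ
open import Data.Product using (_×_; _,_; proj₁; proj₂; ∃)
open import Data.Empty using (⊥-elim)
open import Relation.Nullary using (¬_; Dec; yes; no)
open import Relation.Binary using (tri<; tri≈; tri>)
open import Relation.Binary.PropositionalEquality

-- p exceeds x in some coordinate (constructively: p is not below x).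
Exceeds : {q : ℕ} → Point q → Point q → Set
Exceeds {q} p x = ∃ λ (k : Fin q) → x k < p k

Escaping : {q : ℕ} → List (Point q) → Set
Escaping = AllPairs (λ x y → Exceeds y x)

allPairs-lookup : ∀ {A : Set} {R : A → A → Set} {xs : List A} → AllPairs R xs →
                  (a b : Fin (length xs)) → a Fin.< b → R (lookup xs a) (lookup xs b)
allPairs-lookup (Rx ∷ _)    Fin.zero    (Fin.suc b) _         = All.lookup Rx (∈-lookup b)
allPairs-lookup (_ ∷ Rxs)   (Fin.suc a) (Fin.suc b) (s<s a<b) = allPairs-lookup Rxs a b a<b

all-positions : ∀ {A : Set} {P : A → Set} (xs : List A) →
                (∀ j → P (lookup xs j)) → All P xs
all-positions {P = P} xs Pj = subst (All P) (tabulate-lookup xs) (tabulate⁺ Pj)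

escaping-∷ʳ : ∀ {q} {h : List (Point q)} {p : Point q} →
              Escaping h → All (Exceeds p) h → Escaping (h ∷ʳ p)
escaping-∷ʳ esc exceeds = AllPairsₚ.++⁺ esc ([] ∷ []) (All.map (_∷ []) exceeds)

module BuilderStrategy {q : ℕ} (n M : ℕ)
  (long-reaches : ∀ (h : List (Point q)) → Escaping h → All Positive h →
                  M < length h → Reached n h) where

  select : ∀ {h : List (Point q)} {r} (js : List (Fin (length h))) {cs} →
           (∀ p → Positive p → All (λ c → Satisfies h c p) cs →
              All (λ j → Exceeds p (lookup h j)) js → Win n (h ∷ʳ p) r) →
           StageWin n h r cs
  select []       continue = end (λ p pos sats → continue p pos sats [])
  select (j ∷ js) continue = step j λ k →
    select js λ { p pos (s ∷ sats) exceeded → continue p pos sats ((k , s) ∷ exceeded) }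

  length-snoc+ : ∀ (h : List (Point q)) p r → length (h ∷ʳ p) + r ≡ length h + suc r
  length-snoc+ h p r = trans (cong (_+ r) (length-++ h)) (+-assoc (length h) 1 r)

  builder-from : ∀ r (h : List (Point q)) → Escaping h → All Positive h →
                 M < length h + r → Win n h r
  builder-from zero    h esc pos long =
    done (long-reaches h esc pos (subst (M <_) (+-identityʳ (length h)) long))
  builder-from (suc r) h esc pos long = stage (select (allFin (length h)) continue)
    where
      continue : ∀ p → Positive p → All (λ c → Satisfies h c p) [] →
                 All (λ j → Exceeds p (lookup h j)) (allFin (length h)) → Win n (h ∷ʳ p) r
      continue p pos-p _ exceeded =
        builder-from r (h ∷ʳ p)
          (escaping-∷ʳ esc (all-positions h (λ j → All.lookup exceeded (∈-allFin j))))
          (∷ʳ⁺ pos pos-p)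
          (subst (M <_) (sym (length-snoc+ h p r)) long)

  builder-wins : BuilderWinsIn q n (M + 1)
  builder-wins = builder-from (M + 1) [] [] [] (m<m+n M z<s)

module CoordinatorStrategy {q : ℕ} (n M : ℕ) (e : ℕ → Point q)
  (positive : ∀ i → Positive (e i))
  (below    : ∀ i k → e i k < n)
  (escaping : ∀ {i j} → j < i → i < M → Exceeds (e i) (e j)) where

  Played : ℕ → List (Point q) → Set
  Played i h = All (λ y → ∃ λ j → j < i × y ≡ e j) h

  never-reached : ∀ {i h} → Played i h → ¬ Reached n h
  never-reached {i} played = All¬⇒¬Any (All.map small played)
    where
      small : ∀ {y} → (∃ λ j → j < i × y ≡ e j) → ¬ ∃ λ k → n ≤ y k
      small (j , _ , refl) (k , n≤) = <⇒≱ (below j k) n≤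

  played-suc : ∀ {i h} → Played i h → Played (suc i) h
  played-suc = All.map λ { (j , j<i , eq) → j , m<n⇒m<1+n j<i , eq }

  mutual
    coordinator-win : ∀ {i h r} → Played i h → Win n h r → M < i + r
    coordinator-win played (done reached) = ⊥-elim (never-reached played reached)
    coordinator-win {i} {r = suc r} played (stage sw) = subst (M <_) (sym (+-suc i r)) (stage-bound (i <? M))
      where
        stage-bound : Dec (i < M) → M < suc i + r
        stage-bound (yes i<M) = coordinator-stage played i<M [] sw
        stage-bound (no  i≮M) = s≤s (≤-trans (≮⇒≥ i≮M) (m≤m+n i r))

    coordinator-stage : ∀ {i h r cs} → Played i h → i < M →
                        All (λ c → Satisfies h c (e i)) cs →
                        StageWin n h r cs → M < suc i + r
    coordinator-stage {i} played i<M sats (end play) =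
      coordinator-win (∷ʳ⁺ (played-suc played) (i , ≤-refl , refl)) (play (e i) (positive i) sats)
    coordinator-stage {i} played i<M sats (step j answer)
      with All.lookup played (∈-lookup j)
    ... | j′ , j′<i , eq with escaping j′<i i<M
    ... | k , lt = coordinator-stage played i<M (subst (λ y → y k < e i k) (sym eq) lt ∷ sats) (answer k)

  coordinator-delays : ∀ N → BuilderWinsIn q n N → M + 1 ≤ N
  coordinator-delays N w = subst (_≤ N) (+-comm 1 M) (coordinator-win {0} [] w)

-- Base-B digits of a number, least significant first, each shifted into [1,B].
module MixedRadix (B : ℕ) .{{_ : NonZero B}} where

  digits : ∀ q → ℕ → Point q
  digits (suc q) i Fin.zero    = suc (i % B)
  digits (suc q) i (Fin.suc k) = digits q (i / B) k

  digits-positive : ∀ q i → Positive (digits q i)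
  digits-positive (suc q) i Fin.zero    = z<s
  digits-positive (suc q) i (Fin.suc k) = digits-positive q (i / B) k

  digits-≤ : ∀ q i k → digits q i k ≤ B
  digits-≤ (suc q) i Fin.zero    = m%n<n i B
  digits-≤ (suc q) i (Fin.suc k) = digits-≤ q (i / B) k

  same-quotient-< : ∀ {i j} → j < i → j / B ≡ i / B → j % B < i % B
  same-quotient-< {i} {j} j<i same = +-cancelʳ-< ((i / B) * B) (j % B) (i % B) (begin-strict
    j % B + (i / B) * B ≡⟨ cong (λ t → j % B + t * B) (sym same) ⟩
    j % B + (j / B) * B ≡⟨ m≡m%n+[m/n]*n j B ⟨
    j                   <⟨ j<i ⟩
    i                   ≡⟨ m≡m%n+[m/n]*n i B ⟩
    i % B + (i / B) * B ∎)
    where open ≤-Reasoning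

  digits-escaping : ∀ q {i j} → j < i → i < B ^ q → Exceeds (digits q i) (digits q j)
  digits-escaping zero    {suc i} j<i (s<s ())
  digits-escaping (suc q) {i} {j} j<i i<B^q with <-cmp (j / B) (i / B)
  ... | tri< lt _ _ =
    let k , below = digits-escaping q lt (m<n*o⇒m/o<n (subst (i <_) (*-comm B (B ^ q)) i<B^q))
    in Fin.suc k , below
  ... | tri≈ _ same _ = Fin.zero , s<s (same-quotient-< j<i same)
  ... | tri> _ _ gt   = ⊥-elim (<⇒≱ gt (/-monoˡ-≤ B (<⇒≤ j<i)))

  [d+iB]/B≡i : ∀ d i → d < B → (d + i * B) / B ≡ i
  [d+iB]/B≡i d i d<B = begin
    (d + i * B) / B     ≡⟨ +-distrib-/ d (i * B) remainders<B ⟩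
    d / B + i * B / B   ≡⟨ cong₂ _+_ (m<n⇒m/n≡0 d<B) (m*n/n≡m i B) ⟩
    i                   ∎
    where
      open ≡-Reasoning
      remainders<B : d % B + (i * B) % B < B
      remainders<B = subst₂ (λ a b → a + b < B) (sym (m<n⇒m%n≡m d<B)) (sym (m*n%n≡0 i B))
                       (subst (_< B) (sym (+-identityʳ d)) d<B)

  [d+iB]%B≡d : ∀ d i → d < B → (d + i * B) % B ≡ d
  [d+iB]%B≡d d i d<B = trans ([m+kn]%n≡m%n d i B) (m<n⇒m%n≡m d<B)

  digits-onto : ∀ q (p : Point q) → Positive p → (∀ k → p k ≤ B) →
                ∃ λ i → i < B ^ q × (∀ k → digits q i k ≡ p k)
  digits-onto zero    p _   _   = 0 , z<s , λ ()
  digits-onto (suc q) p pos ≤B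
    with i , i<B^q , tail ← digits-onto q (λ k → p (Fin.suc k)) (λ k → pos (Fin.suc k)) (λ k → ≤B (Fin.suc k))
    = d + i * B , bound , digits≗p
    where
      d : ℕ
      d = pred (p Fin.zero)
      suc-d : suc d ≡ p Fin.zero
      suc-d = suc-pred (p Fin.zero) {{>-nonZero (pos Fin.zero)}}
      d<B : d < B
      d<B = subst (_≤ B) (sym suc-d) (≤B Fin.zero)
      bound : d + i * B < B ^ suc q
      bound = begin-strict
        d + i * B   <⟨ +-monoˡ-< (i * B) d<B ⟩
        suc i * B   ≤⟨ *-monoˡ-≤ B i<B^q ⟩
        B ^ q * B   ≡⟨ *-comm (B ^ q) B ⟩
        B ^ suc q   ∎
        where open ≤-Reasoning
      digits≗p : ∀ k → digits (suc q) (d + i * B) k ≡ p k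
      digits≗p Fin.zero    = trans (cong suc ([d+iB]%B≡d d i d<B)) suc-d
      digits≗p (Fin.suc k) = trans (cong (λ t → digits q t k) ([d+iB]/B≡i d i d<B)) (tail k)

  InBox : ∀ {q} → Point q → Set
  InBox p = Positive p × (∀ k → p k ≤ B)

  -- Pigeonhole: an escaping list inside the box has at most B^q points, since
  -- two positions with the same digit address would carry equal points.
  box-escaping-length : ∀ q (h : List (Point q)) → Escaping h → All InBox h → length h ≤ B ^ q
  box-escaping-length q h esc box = ≮⇒≥ λ long →
    let a , b , a<b , same = Finₚ.pigeonhole long code
        k , lt = allPairs-lookup esc a b a<b
    in <-irrefl (same-point a b same k) lt
    where
      address : (j : Fin (length h)) → ∃ λ i → i < B ^ q × (∀ k → digits q i k ≡ lookup h j k)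
      address j = let pos , ≤B = All.lookup box (∈-lookup j) in digits-onto q (lookup h j) pos ≤B
      code : Fin (length h) → Fin (B ^ q)
      code j = fromℕ< (proj₁ (proj₂ (address j)))
      same-point : ∀ a b → code a ≡ code b → ∀ k → lookup h a k ≡ lookup h b k
      same-point a b same k = begin
        lookup h a k                       ≡⟨ proj₂ (proj₂ (address a)) k ⟨
        digits q (proj₁ (address a)) k     ≡⟨ cong (λ t → digits q t k) same-address ⟩
        digits q (proj₁ (address b)) k     ≡⟨ proj₂ (proj₂ (address b)) k ⟩
        lookup h b k                       ∎
        where
          open ≡-Reasoning
          same-address : proj₁ (address a) ≡ proj₁ (address b)
          same-address = trans (sym (Finₚ.toℕ-fromℕ< _)) (trans (cong toℕ same) (Finₚ.toℕ-fromℕ< _))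

  long-escaping-reaches : ∀ q (h : List (Point q)) → Escaping h → All Positive h →
                          B ^ q < length h → Reached (suc B) h
  long-escaping-reaches q h esc pos long
    with Any.any? (λ p → Finₚ.any? (λ k → suc B ≤? p k)) h
  ... | yes reached = reached
  ... | no  ¬reached = ⊥-elim (<⇒≱ long (box-escaping-length q h esc in-box))
    where
      in-box : All InBox h
      in-box = All.zipWith (λ { (pos-p , ¬big) → pos-p , λ k → ≮⇒≥ (λ big → ¬big (k , big)) })
                 (pos , ¬Any⇒All¬ h ¬reached)

positive-reaches-one : ∀ q (h : List (Point (suc q))) → All Positive h → 0 < length h → Reached 1 h
positive-reaches-one q (_ ∷ _) (pos ∷ _) _ = here (Fin.zero , pos Fin.zero)

needs-a-stage : ∀ {q n N} → BuilderWinsIn q n N → 1 ≤ N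
needs-a-stage (stage _) = s≤s z≤n
needs-a-stage (done ())

lemma3 : (q n : ℕ) → 1 ≤ q → 1 ≤ n →
    BuilderWinsIn q n ((n ∸ 1) ^ q + 1)
    × (∀ (N : ℕ) → BuilderWinsIn q n N → (n ∸ 1) ^ q + 1 ≤ N)
lemma3 q       zero          _  ()
lemma3 zero    (suc zero)    () _
lemma3 (suc q) (suc zero)    _  _ =
  BuilderStrategy.builder-wins 1 0 (λ h _ → positive-reaches-one q h) ,
  λ N → needs-a-stage
lemma3 q       (suc (suc c)) _  _ =
  BuilderStrategy.builder-wins n B^q (long-escaping-reaches q) ,
  CoordinatorStrategy.coordinator-delays n B^q (digits q) (digits-positive q)
    (λ i k → s≤s (digits-≤ q i k)) (digits-escaping q)
  where
    open MixedRadix (suc c)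
    n B^q : ℕ
    n   = suc (suc c)
    B^q = suc c ^ q
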